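{- A filter $\mathcal{F}$ on a semigroup $G$ respects recurrence if and only if for every $\mathcal{F}$-large set $H$, every $n\ge1$ and every $n$-recurrent set $A\subseteq G$, there are $\mathcal{F}$-positively many $g\in G$ (i.e. the set of such $g$ is $\mathcal{F}$-positive) for which there exists an $(n-1)$-recurrent set $A'\subseteq\partial_g A$ with $A'\setminus Hg^{ -1}$ $\mathcal{F}$-small.
   Context: A filter $\mathcal{F}$ on $G$: nonempty family of subsets not containing $\emptyset$, closed upward and under finite intersections; $\mathcal{F}$-large means in $\mathcal{F}$; $\mathcal{F}$-small means the complement is in $\mathcal{F}$; $\mathcal{F}$-positive means not $\mathcal{F}$-small. $Ag^{ -1}:=\{h : hg\in A\}$, $\partial_gA := A\cap Ag^{ -1}$. Recurrence: $A$ is $0$-recurrent if $\mathcal{F}$-positive; for $n\ge1$, $\Delta^n(A) := \{g : \partial_gA \text{ is } (n-1)\text{ -recurrent}\}$ and $A$ is $n$-recurrent if $\Delta^n(A)$ is $\mathcal{F}$-positive. $\mathcal{F}$ respects recurrence if for all $n\ge1$ and all $A,\tilde A\subseteq G$ with $A\triangle\tilde A$ $\mathcal{F}$-small, $A$ is $n$-recurrent iff $\tilde A$ is $n$-recurrent. -}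

module Defs where

open import Level using (0ℓ)
open import Data.Bool using (Bool; true; false; _∧_; not; _xor_; T)
open import Data.Nat using (ℕ; zero; suc)
open import Data.Product using (Σ; ∃)
open import Relation.Nullary using (¬_)
open import Relation.Nullary.Decidable using (⌊_⌋)
open import Axiom.ExcludedMiddle using (ExcludedMiddle)

-- Subsets of G are characteristic functions G → Bool (classically the power set).
Subset : Set → Set
Subset G = G → Bool

module _ {G : Set} where

  _∈_ : G → Subset G → Set
  x ∈ A = T (A x)

  _⊆_ : Subset G → Subset G → Set
  A ⊆ B = ∀ x → x ∈ A → x ∈ B

  ∅ : Subset G
  ∅ _ = false

  _∩_ : Subset G → Subset G → Subset G
  (A ∩ B) x = A x ∧ B x

  ∁ : Subset G → Subset G
  ∁ A x = not (A x)

  _∖_ : Subset G → Subset G → Subset G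
  (A ∖ B) x = A x ∧ not (B x)

  _△_ : Subset G → Subset G → Subset G
  (A △ B) x = A x xor B x

  record IsFilter (F : Subset G → Set) : Set where
    field
      nonempty : ∃ F
      ∅∉       : ¬ F ∅
      upward   : ∀ {A B} → A ⊆ B → F A → F B
      ∩-closed : ∀ {A B} → F A → F B → F (A ∩ B)

  module _ (F : Subset G → Set) where

    Large : Subset G → Set
    Large A = F A

    Small : Subset G → Set
    Small A = F (∁ A)

    Positive : Subset G → Set
    Positive A = ¬ Small A

module _ {G : Set} (_∙_ : G → G → G) where

  _·_⁻¹ : Subset G → G → Subset G
  (A · g ⁻¹) h = A (h ∙ g)

  ∂ : G → Subset G → Subset G
  ∂ g A = A ∩ (A · g ⁻¹)

  -- Recurrence.  Subsets are Bool-valued, so the set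
  -- Δ^n(A) = { g : ∂_g A is (n-1)-recurrent } is formed using excluded middle.
  module _ (lem : ExcludedMiddle 0ℓ) (F : Subset G → Set) where

    Recurrent : ℕ → Subset G → Set
    Δ : ℕ → Subset G → Subset G

    Recurrent zero A = Positive F A
    Recurrent (suc n) A = Positive F (Δ (suc n) A)

    -- Δ n A is Δ^n(A) for n ≥ 1 (Δ 0 A is an unused dummy value, ∅).
    Δ zero A = ∅
    Δ (suc n) A g = ⌊ lem {Recurrent n (∂ g A)} ⌋

    RespectsRecurrence : Set
    RespectsRecurrence =
      ∀ (n : ℕ) → 1 Data.Nat.≤ n → ∀ (A Ã : Subset G) →
      Small F (A △ Ã) → (Recurrent n A → Recurrent n Ã) Data.Product.× (Recurrent n Ã → Recurrent n A)

module Submission where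

-- (⇒) Given H and A, the set Ã = A ∩ H differs from A by a subset of ∁H, so it is
--     n-recurrent as well.  For each of the F-positively many g ∈ Δⁿ(Ã) the set
--     A′ = ∂_g Ã works: it lies in ∂_g A and A′ ∖ Hg⁻¹ is empty.
-- (⇐) By induction on n we show that Small (A △ Ã) and n-recurrence of A give
--     n-recurrence of Ã (the converse follows by symmetry of △).  For n = k+1 apply the trimming property with
--     H = ∁(A △ Ã): for positively many g we get a k-recurrent A′ ⊆ ∂_g A, and
--     A′ differs from A′ ∩ ∂_g Ã only inside (A △ Ã) ∪ (A′ ∖ Hg⁻¹), an F-small set;
--     by induction and monotonicity of recurrence, ∂_g Ã is k-recurrent.

open import Defs
open import Level using (0ℓ)
open import Data.Nat using (ℕ; zero; suc; _≤_; _∸_; s≤s; z≤n)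
open import Data.Product using (Σ; _×_; _,_; proj₁; proj₂)
open import Data.Sum using (_⊎_; inj₁; inj₂; [_,_]; map₂)
open import Data.Bool using (true; false; not; _∧_; _xor_; T)
open import Data.Bool.Properties using (T-∧; xor-comm)
open import Data.Unit using (tt)
open import Relation.Nullary using (¬_)
open import Relation.Nullary.Decidable using (⌊_⌋; toWitness; fromWitness)
open import Relation.Binary.PropositionalEquality using (_≡_; subst)
open import Algebra.Structures using (IsSemigroup)
open import Axiom.ExcludedMiddle using (ExcludedMiddle)
open import Function.Bundles using (_⇔_; mk⇔; Equivalence)

∧-defect : ∀ a b ã b̃ → T (a ∧ b) → T (not (ã ∧ b̃)) →
           T (a xor ã) ⊎ T (b xor b̃)
∧-defect true true false b̃    _ _ = inj₁ tt
∧-defect true true true  false _ _ = inj₂ tt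

module SetAlgebra {G : Set} where

  ∩-intro : ∀ {A B : Subset G} {x} → x ∈ A → x ∈ B → x ∈ (A ∩ B)
  ∩-intro a b = Equivalence.from T-∧ (a , b)

  ∩-elimˡ : ∀ {A B : Subset G} {x} → x ∈ (A ∩ B) → x ∈ A
  ∩-elimˡ t = proj₁ (Equivalence.to T-∧ t)

  ∩-elimʳ : ∀ {A B : Subset G} {x} → x ∈ (A ∩ B) → x ∈ B
  ∩-elimʳ t = proj₂ (Equivalence.to T-∧ t)

  ∁-elim : ∀ {A : Subset G} {x} → x ∈ ∁ A → ¬ x ∈ A
  ∁-elim {A} {x} with A x
  ... | true  = λ ()
  ... | false = λ _ ()

  ∁-intro : ∀ {A : Subset G} {x} → ¬ x ∈ A → x ∈ ∁ A
  ∁-intro {A} {x} with A x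
  ... | true  = λ x∉A → x∉A tt
  ... | false = λ _ → tt

  ∁-antitone : ∀ {A B : Subset G} → A ⊆ B → ∁ B ⊆ ∁ A
  ∁-antitone {A} {B} A⊆B x x∉B = ∁-intro {A = A} λ x∈A → ∁-elim {A = B} x∉B (A⊆B x x∈A)

  ∁-cover : ∀ {A B C : Subset G} → (∀ x → x ∈ C → x ∈ A ⊎ x ∈ B) →
            (∁ A ∩ ∁ B) ⊆ ∁ C
  ∁-cover {A} {B} {C} cover x t = ∁-intro {A = C} λ x∈C →
    [ ∁-elim {A = A} (∩-elimˡ {A = ∁ A} {B = ∁ B} t)
    , ∁-elim {A = B} (∩-elimʳ {A = ∁ A} {B = ∁ B} t)
    ] (cover x x∈C)

  ∁∁-intro : ∀ {A : Subset G} → A ⊆ ∁ (∁ A)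
  ∁∁-intro {A} x x∈A = ∁-intro {A = ∁ A} λ x∉A → ∁-elim {A = A} x∉A x∈A

  △-sym : ∀ {A B : Subset G} → (A △ B) ⊆ (B △ A)
  △-sym {A} {B} x = subst T (xor-comm (A x) (B x))

  △-cover : ∀ {A Ã : Subset G} x → x ∈ A → x ∈ Ã ⊎ x ∈ (A △ Ã)
  △-cover {A} {Ã} x with A x | Ã x
  ... | true | true  = λ _ → inj₁ tt
  ... | true | false = λ _ → inj₂ tt

  △-∩-self : ∀ {B C : Subset G} → (B △ (B ∩ C)) ⊆ (B ∖ C)
  △-∩-self {B} {C} x with B x | C x
  ... | true | true  = λ ()
  ... | true | false = λ _ → tt

  ∖-∁-intro : ∀ {A B : Subset G} {x} → x ∈ A → x ∈ B → x ∈ (A ∖ ∁ B)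
  ∖-∁-intro {A} {B} {x} with A x | B x
  ... | true | true = λ _ _ → tt

module Shifts {G : Set} (_∙_ : G → G → G) where
  open SetAlgebra

  ∂-mono : ∀ {A B : Subset G} g → A ⊆ B → ∂ _∙_ g A ⊆ ∂ _∙_ g B
  ∂-mono {A} {B} g A⊆B x t =
    ∩-intro {A = B} {B = _·_⁻¹ _∙_ B g}
      (A⊆B x (∩-elimˡ {A = A} {B = A·g} t)) (A⊆B (x ∙ g) (∩-elimʳ {A = A} {B = A·g} t))
    where
    A·g : Subset G
    A·g = _·_⁻¹ _∙_ A g

  ∂-defect : ∀ {A Ã : Subset G} g x → x ∈ ∂ _∙_ g A → x ∈ ∁ (∂ _∙_ g Ã) →
             x ∈ (A △ Ã) ⊎ (x ∙ g) ∈ (A △ Ã)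
  ∂-defect {A} {Ã} g x = ∧-defect (A x) (A (x ∙ g)) (Ã x) (Ã (x ∙ g))

  shrink-defect : ∀ {A Ã A′ : Subset G} g → A′ ⊆ ∂ _∙_ g A → ∀ x →
    x ∈ (A′ △ (A′ ∩ ∂ _∙_ g Ã)) →
    x ∈ (A △ Ã) ⊎ x ∈ (A′ ∖ _·_⁻¹ _∙_ (∁ (A △ Ã)) g)
  shrink-defect {A} {Ã} {A′} g A′⊆∂A x t =
    map₂ (∖-∁-intro {A = A′} {B = _·_⁻¹ _∙_ (A △ Ã) g} x∈A′)
         (∂-defect {A = A} {Ã = Ã} g x (A′⊆∂A x x∈A′) x∉∂Ã)
    where
    x∈A′∖∂Ã : x ∈ (A′ ∖ ∂ _∙_ g Ã)
    x∈A′∖∂Ã = △-∩-self {B = A′} {C = ∂ _∙_ g Ã} x t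
    x∈A′ : x ∈ A′
    x∈A′ = ∩-elimˡ {A = A′} {B = ∁ (∂ _∙_ g Ã)} x∈A′∖∂Ã
    x∉∂Ã : x ∈ ∁ (∂ _∙_ g Ã)
    x∉∂Ã = ∩-elimʳ {A = A′} {B = ∁ (∂ _∙_ g Ã)} x∈A′∖∂Ã

  ∂-∩-inside : ∀ {A H : Subset G} g x → ¬ x ∈ (∂ _∙_ g (A ∩ H) ∖ _·_⁻¹ _∙_ H g)
  ∂-∩-inside {A} {H} g x t = ∁-elim {A = H} xg∉H xg∈H
    where
    x∈∂ : x ∈ ∂ _∙_ g (A ∩ H)
    x∈∂ = ∩-elimˡ {A = ∂ _∙_ g (A ∩ H)} {B = ∁ (_·_⁻¹ _∙_ H g)} t
    xg∉H : (x ∙ g) ∈ ∁ H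
    xg∉H = ∩-elimʳ {A = ∂ _∙_ g (A ∩ H)} {B = ∁ (_·_⁻¹ _∙_ H g)} t
    xg∈H : (x ∙ g) ∈ H
    xg∈H = ∩-elimʳ {A = A} {B = H}
             (∩-elimʳ {A = A ∩ H} {B = _·_⁻¹ _∙_ (A ∩ H) g} x∈∂)

module FilterFacts {G : Set} (F : Subset G → Set) (isF : IsFilter F) where
  open IsFilter isF
  open SetAlgebra

  small-⊆ : ∀ {A B : Subset G} → A ⊆ B → Small F B → Small F A
  small-⊆ A⊆B = upward (∁-antitone A⊆B)

  positive-⊇ : ∀ {A B : Subset G} → A ⊆ B → Positive F A → Positive F B
  positive-⊇ A⊆B posA smallB = posA (small-⊆ A⊆B smallB)

  small-cover : ∀ {A B C : Subset G} → (∀ x → x ∈ C → x ∈ A ⊎ x ∈ B) →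
                Small F A → Small F B → Small F C
  small-cover cover smallA smallB = upward (∁-cover cover) (∩-closed smallA smallB)

  small-empty : ∀ {A : Subset G} → (∀ x → ¬ x ∈ A) → Small F A
  small-empty {A} empty = upward (λ x _ → ∁-intro {A = A} (empty x)) (proj₂ nonempty)

  large⇒∁-small : ∀ {H : Subset G} → Large F H → Small F (∁ H)
  large⇒∁-small = upward ∁∁-intro

  small-△-sym : ∀ {A B : Subset G} → Small F (A △ B) → Small F (B △ A)
  small-△-sym {A} {B} = small-⊆ (△-sym {A = B} {B = A})

  positive-△ : ∀ {A Ã : Subset G} → Small F (A △ Ã) → Positive F A → Positive F Ã
  positive-△ {A} {Ã} small△ posA smallÃ =
    posA (small-cover (△-cover {A = A} {Ã = Ã}) smallÃ small△)

module RecurrenceFacts {G : Set} (_∙_ : G → G → G) (lem : ExcludedMiddle 0ℓ)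
                       (F : Subset G → Set) (isF : IsFilter F) where
  open SetAlgebra
  open Shifts _∙_
  open FilterFacts F isF

  Rec : ℕ → Subset G → Set
  Rec = Recurrent _∙_ lem F

  Δ-intro : ∀ {n A} g → Rec n (∂ _∙_ g A) → g ∈ Δ _∙_ lem F (suc n) A
  Δ-intro g = fromWitness

  Δ-elim : ∀ {n A} g → g ∈ Δ _∙_ lem F (suc n) A → Rec n (∂ _∙_ g A)
  Δ-elim g = toWitness

  recurrent-mono : ∀ n {A B : Subset G} → A ⊆ B → Rec n A → Rec n B
  recurrent-mono zero    A⊆B = positive-⊇ A⊆B
  recurrent-mono (suc n) {A} {B} A⊆B = positive-⊇ λ g g∈ΔA →
    Δ-intro {A = B} g (recurrent-mono n (∂-mono g A⊆B) (Δ-elim {A = A} g g∈ΔA))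

  Trimming : Subset G → ℕ → Subset G → G → Set
  Trimming H m A g = Σ (Subset G) λ A′ →
    (A′ ⊆ ∂ _∙_ g A) × Rec m A′ × Small F (A′ ∖ _·_⁻¹ _∙_ H g)

  TrimmingProperty : Set
  TrimmingProperty = ∀ (H : Subset G) → Large F H → ∀ (n : ℕ) → 1 ≤ n →
    ∀ (A : Subset G) → Rec n A →
    Positive F (λ g → ⌊ lem {Trimming H (n ∸ 1) A g} ⌋)

  -- (⇒) Replace A by A ∩ H, which is still n-recurrent; the sets ∂_g (A ∩ H)
  -- for g ∈ Δⁿ(A ∩ H) are trimmings of A.
  respects⇒trimming : RespectsRecurrence _∙_ lem F → TrimmingProperty
  respects⇒trimming respects H largeH (suc m) 1≤n A recA =
    positive-⊇ trimmable (proj₁ (respects (suc m) 1≤n A A∩H cut-small) recA)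
    where
    A∩H : Subset G
    A∩H = A ∩ H

    cut-small : Small F (A △ A∩H)
    cut-small = small-⊆ (λ x t → ∩-elimʳ {A = A} {B = ∁ H} (△-∩-self {B = A} {C = H} x t))
                        (large⇒∁-small largeH)

    trimmable : Δ _∙_ lem F (suc m) A∩H ⊆ (λ g → ⌊ lem {Trimming H m A g} ⌋)
    trimmable g g∈Δ = fromWitness
      ( ∂ _∙_ g A∩H
      , ∂-mono g (λ x → ∩-elimˡ {A = A} {B = H})
      , Δ-elim {A = A∩H} g g∈Δ
      , small-empty (∂-∩-inside {A = A} {H = H} g) )

  -- At level k+1, trim A with respect to H = ∁(A △ Ã); each trimming A′ at g is
  -- almost equal to A′ ∩ ∂_g Ã, which by induction is k-recurrent.
  trimming⇒transfer : TrimmingProperty → ∀ n {A Ã : Subset G} →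
                      Small F (A △ Ã) → Rec n A → Rec n Ã
  trimming⇒transfer trim zero          small△ = positive-△ small△
  trimming⇒transfer trim (suc k) {A} {Ã} small△ recA =
    positive-⊇ (λ g t → ∂Ã-recurrent g (toWitness t))
               (trim (∁ (A △ Ã)) small△ (suc k) (s≤s z≤n) A recA)
    where
    ∂Ã-recurrent : ∀ g → Trimming (∁ (A △ Ã)) k A g → g ∈ Δ _∙_ lem F (suc k) Ã
    ∂Ã-recurrent g (A′ , A′⊆∂A , recA′ , smallOutside) =
      Δ-intro {A = Ã} g (recurrent-mono k (λ x → ∩-elimʳ {A = A′} {B = ∂ _∙_ g Ã})
        (trimming⇒transfer trim k
          (small-cover (shrink-defect {A = A} {Ã = Ã} g A′⊆∂A) small△ smallOutside)
          recA′))

  trimming⇒respects : TrimmingProperty → RespectsRecurrence _∙_ lem F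
  trimming⇒respects trim n _ A Ã small△ =
    trimming⇒transfer trim n small△ ,
    trimming⇒transfer trim n (small-△-sym {A = A} {B = Ã} small△)

mainTheorem5 : (G : Set) (_∙_ : G → G → G) → IsSemigroup _≡_ _∙_ →
    (lem : ExcludedMiddle 0ℓ) (F : Subset G → Set) → IsFilter F →
    RespectsRecurrence _∙_ lem F ⇔
      (∀ (H : Subset G) → Large F H → ∀ (n : ℕ) → 1 ≤ n → ∀ (A : Subset G) →
        Recurrent _∙_ lem F n A →
        Positive F (λ g → ⌊ lem {Σ (Subset G) (λ A′ →
          (A′ ⊆ ∂ _∙_ g A) × Recurrent _∙_ lem F (n ∸ 1) A′ ×
          Small F (A′ ∖ (_·_⁻¹ _∙_ H g)))} ⌋))
mainTheorem5 G _∙_ _ lem F isF = mk⇔ respects⇒trimming trimming⇒respects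
  where open RecurrenceFacts _∙_ lem F isF
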